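{- Let $n\in\mathbb{N}$ and $w\in\mathcal{E}_n$. Then $$L(w)=L(w^{[n-1]})+L(w_{[n-1]}).$$
   Context: For $n\in\mathbb{N}$ let $[n]=\{1,\dots,n\}$, $[\pm n]_0=\{ -n,\dots,n\}$. $B_n$ is the group of permutations $w$ of $[\pm n]_0$ with $w(-j)=-w(j)$ (composition of maps); $S_n=\{w\in B_n: w(j)>0\ \forall j\in[n]\}$. $L(w)=\tfrac12\#\{(i,j)\in[\pm n]_0^2: i<j,\ w(i)>w(j),\ i\not\equiv j\pmod 2\}$. $\mathcal{C}_{n,0}=\{w\in B_n: |w(j)|\equiv j\pmod 2\ \forall j\in[n]\}$. Every $w\in B_n$ factors uniquely as $w=w^{[n-1]}w_{[n-1]}$ with $w^{[n-1]}$ ascending ($w^{[n-1]}(1)<\dots<w^{[n-1]}(n)$) and $w_{[n-1]}\in S_n$. $\mathcal{E}_n=\{w\in\mathcal{C}_{n,0}: w^{[n-1]}\in\mathcal{C}_{n,0}\text{ and }w_{[n-1]}\in\mathcal{C}_{n,0}\}$. -}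

module Defs where

open import Data.Nat as ℕ using (ℕ; zero; suc; ⌊_/2⌋; _%_)
open import Data.Integer as ℤ using (ℤ; +_; -[1+_]; -_; _-_; ∣_∣; _<_; _>_; _<?_)
open import Data.Fin using (Fin; toℕ; fromℕ<)
open import Data.List using (List; map; upTo; cartesianProduct; filter; length)
open import Data.Product using (_×_; _,_)
open import Relation.Binary.PropositionalEquality using (_≡_; _≢_)
open import Relation.Nullary using (yes; no; ¬_)
open import Relation.Nullary.Decidable using (_×-dec_)
open import Data.Nat.Properties as ℕP using ()

-- An element w of B_n is represented by its values (w(1),...,w(n)) : Fin n → ℤ
-- (index j : Fin n stands for j+1 ∈ [n]).  w(0)=0 and w(-j)=-w(j) are forced.

IsB : (n : ℕ) → (Fin n → ℤ) → Set
IsB n w =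
  (∀ j → w j ≢ + 0) ×
  (∀ j → ∣ w j ∣ ℕ.≤ n) ×
  (∀ i j → ∣ w i ∣ ≡ ∣ w j ∣ → i ≡ j)

IsS : (n : ℕ) → (Fin n → ℤ) → Set
IsS n w = IsB n w × (∀ j → w j > + 0)

IsC0 : (n : ℕ) → (Fin n → ℤ) → Set
IsC0 n w = IsB n w × (∀ j → ∣ w j ∣ % 2 ≡ suc (toℕ j) % 2)

Ascending : (n : ℕ) → (Fin n → ℤ) → Set
Ascending n w = ∀ (i j : Fin n) → toℕ i ℕ.< toℕ j → w i < w j

-- extension of w to all of [±n]_0 (values outside [±n]_0 are irrelevant)
ext : {n : ℕ} → (Fin n → ℤ) → ℤ → ℤ
ext {n} w (+ zero) = + 0
ext {n} w (+ suc k) with k ℕP.<? n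
... | yes k<n = w (fromℕ< k<n)
... | no _ = + suc k
ext {n} w -[1+ k ] = - ext w (+ suc k)

pmRange : ℕ → List ℤ
pmRange n = map (λ k → + k - + n) (upTo (suc (2 ℕ.* n)))

oddInversions : {n : ℕ} → (Fin n → ℤ) → List (ℤ × ℤ)
oddInversions {n} w =
  filter (λ p → let i = Data.Product.proj₁ p ; j = Data.Product.proj₂ p in
           (i <? j) ×-dec ((ext w j <? ext w i) ×-dec (∣ i - j ∣ % 2 ℕ.≟ 1)))
         (cartesianProduct (pmRange n) (pmRange n))
  where import Data.Product

L : {n : ℕ} → (Fin n → ℤ) → ℕ
L w = ⌊ length (oddInversions w) /2⌋

module Submission where

-- For F : ℤ → ℤ let inversionCount F R count the pairs (i , j) from R with
-- i < j, F j < F i and j - i odd; L w is half of this count for F = ext w on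
-- R = [±n]_0.  With U = ext u and V = ext v we have ext w = U ∘ V, and:
--  * Additivity.  V is an injective, sign- and parity-preserving permutation of
--    [±n]_0 and U is increasing on each side of 0, so an odd-gap pair is
--    reversed by U ∘ V iff it is reversed by V or its V-image is reversed by U,
--    never both (Composition).  Summing over all pairs and reindexing along V
--    gives count(U ∘ V) = count U + count V (inversionCount-∘).
--  * Evenness.  For odd F the involution (i , j) ↦ (- j , - i) of odd
--    inversions has no fixed points, so every count is even (Evenness) and
--    halving is additive.

open import Defs
open import Data.Nat using (ℕ; _+_)
open import Data.Integer using (ℤ)
open import Data.Fin using (Fin)
open import Relation.Binary.PropositionalEquality using (_≡_)

open import Level using (0ℓ)
open import Function using (_∘_)
open import Function.Bundles using (mk⇔)
open import Data.Empty using (⊥-elim)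
open import Data.Sum using (inj₁; inj₂)
open import Data.Product using (_×_; _,_; proj₁; proj₂; ∃)
open import Data.Bool using (Bool; true; false; _∧_)
open import Data.Bool.Properties using (∧-zeroʳ; ∧-identityʳ)
open import Data.Nat as ℕ using (zero; suc; _*_; _%_; ⌊_/2⌋; z≤n; s≤s)
import Data.Nat.Properties as ℕP
open import Data.Nat.DivMod using (%-distribˡ-+; [m+kn]%n≡m%n)
open import Data.Nat.ListAction using (sum)
open import Data.Nat.ListAction.Properties using (sum-++; sum-↭)
open import Data.Integer as ℤ using (+_; -[1+_]; -_; _-_; ∣_∣; _<_; _≤_; _<?_; _⊖_; +<+; +≤+; -≤+)
import Data.Integer.Properties as ℤP
open import Data.Fin using (toℕ; fromℕ<)
open import Data.Fin.Properties using (toℕ-fromℕ<)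
open import Data.List using (List; []; _∷_; map; filter; length; cartesianProduct; _++_)
open import Data.List.Properties using (map-cong; map-∘; map-++; length-map; filter-notAll)
open import Data.List.Membership.Propositional using (_∈_)
open import Data.List.Membership.Propositional.Properties
  using (∈-map⁻; ∈-map⁺; ∈-upTo⁻; ∈-upTo⁺; ∈-filter⁺)
open import Data.List.Membership.Propositional.Properties.WithK using (unique∧set⇒bag)
import Data.List.Membership.DecPropositional as DecMembership
open import Data.List.Relation.Unary.Any as Any using (Any; here; there)
import Data.List.Relation.Unary.All as All
open import Data.List.Relation.Unary.All.Properties.Core using (¬Any⇒All¬)
open import Data.List.Relation.Unary.AllPairs using (_∷_)
open import Data.List.Relation.Unary.Unique.Propositional using (Unique)
import Data.List.Relation.Unary.Unique.Propositional.Properties as Unique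
open import Data.List.Relation.Binary.Permutation.Propositional using (_↭_)
import Data.List.Relation.Binary.Permutation.Propositional.Properties as ↭
open import Data.List.Relation.Binary.BagAndSetEquality using (∼bag⇒↭)
open import Algebra.Bundles using (AbelianGroup)
open import Algebra.Properties.CommutativeSemigroup ℕP.+-commutativeSemigroup using (interchange)
open import Algebra.Properties.Group (AbelianGroup.group ℤP.+-0-abelianGroup) using (∙-cancelʳ)
open import Relation.Binary.PropositionalEquality
  using (_≢_; refl; sym; trans; cong; cong₂; subst; subst₂; module ≡-Reasoning)
open import Relation.Binary.Definitions using (DecidableEquality; tri<; tri≈; tri>)
open import Relation.Nullary using (Dec; does; yes; no; ¬_; ¬?; contradiction)
open import Relation.Nullary.Decidable using (dec-true; dec-false; does-⇔)
open import Relation.Unary using (Pred; Decidable)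

open ≡-Reasoning

𝟙 : Bool → ℕ
𝟙 true = 1
𝟙 false = 0

∑ : {A : Set} → (A → ℕ) → List A → ℕ
∑ f xs = sum (map f xs)

∑-cong : {A : Set} {f g : A → ℕ} → (∀ x → f x ≡ g x) → ∀ xs → ∑ f xs ≡ ∑ g xs
∑-cong f≗g xs = cong sum (map-cong f≗g xs)

∑-+ : {A : Set} (f g : A → ℕ) (xs : List A) → ∑ (λ x → f x + g x) xs ≡ ∑ f xs + ∑ g xs
∑-+ f g [] = refl
∑-+ f g (x ∷ xs) =
  trans (cong (_+_ (f x + g x)) (∑-+ f g xs)) (interchange (f x) (g x) (∑ f xs) (∑ g xs))

∑-zero : {A : Set} (xs : List A) → ∑ (λ _ → 0) xs ≡ 0
∑-zero [] = refl
∑-zero (x ∷ xs) = ∑-zero xs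

∑-map : {A B : Set} (f : B → ℕ) (g : A → B) (xs : List A) → ∑ f (map g xs) ≡ ∑ (f ∘ g) xs
∑-map f g xs = cong sum (sym (map-∘ xs))

∑-++ : {A : Set} (f : A → ℕ) (xs ys : List A) → ∑ f (xs ++ ys) ≡ ∑ f xs + ∑ f ys
∑-++ f xs ys = trans (cong sum (map-++ f xs ys)) (sum-++ (map f xs) (map f ys))

∑-↭ : {A : Set} (f : A → ℕ) {xs ys : List A} → xs ↭ ys → ∑ f xs ≡ ∑ f ys
∑-↭ f p = sum-↭ (↭.map⁺ f p)

∑-reindex : {A : Set} (f : A → ℕ) (g : A → A) (xs : List A) → map g xs ↭ xs →
  ∑ (f ∘ g) xs ≡ ∑ f xs
∑-reindex f g xs p = trans (sym (∑-map f g xs)) (∑-↭ f p)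

∑-swap : {A B : Set} (F : A → B → ℕ) (xs : List A) (ys : List B) →
  ∑ (λ i → ∑ (F i) ys) xs ≡ ∑ (λ j → ∑ (λ i → F i j) xs) ys
∑-swap F [] ys = sym (∑-zero ys)
∑-swap F (x ∷ xs) ys =
  trans (cong (_+_ (∑ (F x) ys)) (∑-swap F xs ys))
        (sym (∑-+ (F x) (λ j → ∑ (λ i → F i j) xs) ys))

∑-cartesianProduct : {A B : Set} (f : A × B → ℕ) (xs : List A) (ys : List B) →
  ∑ f (cartesianProduct xs ys) ≡ ∑ (λ i → ∑ (λ j → f (i , j)) ys) xs
∑-cartesianProduct f [] ys = refl
∑-cartesianProduct f (x ∷ xs) ys = trans (∑-++ f (map (x ,_) ys) (cartesianProduct xs ys))
  (cong₂ _+_ (∑-map f (x ,_) ys) (∑-cartesianProduct f xs ys))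

length-filter : {A : Set} {P : Pred A 0ℓ} (P? : Decidable P) (xs : List A) →
  length (filter P? xs) ≡ ∑ (λ x → 𝟙 (does (P? x))) xs
length-filter P? [] = refl
length-filter P? (x ∷ xs) with does (P? x)
... | true = cong suc (length-filter P? xs)
... | false = length-filter P? xs

∑∑ : {A : Set} → (A → A → ℕ) → List A → ℕ
∑∑ F xs = ∑ (λ i → ∑ (F i) xs) xs

∑∑-cong : {A : Set} {F G : A → A → ℕ} → (∀ i j → F i j ≡ G i j) → ∀ xs →
  ∑∑ F xs ≡ ∑∑ G xs
∑∑-cong F≗G xs = ∑-cong (λ i → ∑-cong (F≗G i) xs) xs

∑∑-+ : {A : Set} (F G : A → A → ℕ) (xs : List A) →
  ∑∑ (λ i j → F i j + G i j) xs ≡ ∑∑ F xs + ∑∑ G xs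
∑∑-+ F G xs = trans (∑-cong (λ i → ∑-+ (F i) (G i) xs) xs)
                    (∑-+ (λ i → ∑ (F i) xs) (λ i → ∑ (G i) xs) xs)

∑∑-transpose : {A : Set} (F : A → A → ℕ) (xs : List A) →
  ∑∑ F xs ≡ ∑∑ (λ i j → F j i) xs
∑∑-transpose F xs = ∑-swap F xs xs

∑∑-reindex : {A : Set} (F : A → A → ℕ) (g : A → A) (xs : List A) → map g xs ↭ xs →
  ∑∑ (λ i j → F (g i) (g j)) xs ≡ ∑∑ F xs
∑∑-reindex F g xs p =
  trans (∑-cong (λ i → ∑-reindex (F (g i)) g xs p) xs) (∑-reindex (λ a → ∑ (F a) xs) g xs p)

module _ {A : Set} (_≟_ : DecidableEquality A) where

  open DecMembership _≟_ using (_∈?_)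

  unique-⊆-length : ∀ {xs ys : List A} → Unique xs → (∀ {z} → z ∈ xs → z ∈ ys) →
    length xs ℕ.≤ length ys
  unique-⊆-length {[]} _ _ = z≤n
  unique-⊆-length {x ∷ xs} {ys} (x∉xs ∷ xs!) x∷xs⊆ys =
    ℕP.≤-trans (s≤s (unique-⊆-length xs! xs⊆ys-x)) (filter-notAll ≢x? ys x∈ys)
    where
    ≢x? : ∀ z → Dec (z ≢ x)
    ≢x? z = ¬? (z ≟ x)
    xs⊆ys-x : ∀ {z} → z ∈ xs → z ∈ filter ≢x? ys
    xs⊆ys-x z∈xs =
      ∈-filter⁺ ≢x? (x∷xs⊆ys (there z∈xs)) (λ z≡x → All.lookup x∉xs z∈xs (sym z≡x))
    x∈ys : Any (λ z → ¬ (z ≢ x)) ys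
    x∈ys = Any.map (λ x≡z z≢x → z≢x (sym x≡z)) (x∷xs⊆ys (here refl))

  injective-map-↭ : (g : A → A) {xs : List A} → Unique xs → (∀ {x y} → g x ≡ g y → x ≡ y) →
    (∀ {x} → x ∈ xs → g x ∈ xs) → map g xs ↭ xs
  injective-map-↭ g {xs} xs! g-injective g-into =
    ∼bag⇒↭ (unique∧set⇒bag gxs! xs! (mk⇔ gxs⊆xs xs⊆gxs))
    where
    gxs! : Unique (map g xs)
    gxs! = Unique.map⁺ g-injective xs!
    gxs⊆xs : ∀ {z} → z ∈ map g xs → z ∈ xs
    gxs⊆xs z∈gxs with ∈-map⁻ g z∈gxs
    ... | _ , y∈xs , refl = g-into y∈xs
    -- a z ∈ xs missing from map g xs would give a duplicate-free list z ∷ map g xs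
    -- inside xs that is longer than xs
    xs⊆gxs : ∀ {z} → z ∈ xs → z ∈ map g xs
    xs⊆gxs {z} z∈xs with z ∈? map g xs
    ... | yes z∈gxs = z∈gxs
    ... | no z∉gxs =
      contradiction (subst (λ m → suc m ℕ.≤ length xs) (length-map g xs) too-long) (ℕP.<-irrefl refl)
      where
      too-long : length (z ∷ map g xs) ℕ.≤ length xs
      too-long = unique-⊆-length (¬Any⇒All¬ _ z∉gxs ∷ gxs!)
        λ { (here refl) → z∈xs ; (there q) → gxs⊆xs q }

Even : ℕ → Set
Even m = ∃ λ a → m ≡ a + a

double-injective : ∀ {a b} → a + a ≡ b + b → a ≡ b
double-injective {a} {b} eq =
  trans (ℕP.n≡⌊n+n/2⌋ a) (trans (cong ⌊_/2⌋ eq) (sym (ℕP.n≡⌊n+n/2⌋ b)))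

half-+-even : ∀ {m n} → Even m → Even n → ⌊ m + n /2⌋ ≡ ⌊ m /2⌋ + ⌊ n /2⌋
half-+-even (a , refl) (b , refl) = begin
  ⌊ (a + a) + (b + b) /2⌋     ≡⟨ cong ⌊_/2⌋ (interchange a a b b) ⟩
  ⌊ (a + b) + (a + b) /2⌋     ≡⟨ ℕP.n≡⌊n+n/2⌋ (a + b) ⟨
  a + b                       ≡⟨ cong₂ _+_ (ℕP.n≡⌊n+n/2⌋ a) (ℕP.n≡⌊n+n/2⌋ b) ⟩
  ⌊ a + a /2⌋ + ⌊ b + b /2⌋   ∎

⊖-parity : ∀ m n → ∣ m ⊖ n ∣ % 2 ≡ (m + n) % 2
⊖-parity m zero = cong (_% 2) (trans (cong ∣_∣ (ℤP.⊖-≥ z≤n)) (sym (ℕP.+-identityʳ m)))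
⊖-parity zero (suc n) = cong (_% 2) (ℤP.∣⊖∣-< {0} {suc n} (s≤s z≤n))
⊖-parity (suc m) (suc n) = begin
  ∣ suc m ⊖ suc n ∣ % 2  ≡⟨ cong (λ z → ∣ z ∣ % 2) (ℤP.[1+m]⊖[1+n]≡m⊖n m n) ⟩
  ∣ m ⊖ n ∣ % 2          ≡⟨ ⊖-parity m n ⟩
  (m + n) % 2            ≡⟨ [m+kn]%n≡m%n (m + n) 1 2 ⟨
  (m + n + 2) % 2        ≡⟨ cong (_% 2) (ℕP.+-comm (m + n) 2) ⟩
  suc (suc (m + n)) % 2  ≡⟨ cong (λ k → suc k % 2) (ℕP.+-suc m n) ⟨
  (suc m + suc n) % 2    ∎

gap-parity : ∀ a b → ∣ a - b ∣ % 2 ≡ (∣ a ∣ + ∣ b ∣) % 2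
gap-parity (+ p) (+ zero) = refl
gap-parity (+ p) (+ suc q) = ⊖-parity p (suc q)
gap-parity (+ p) -[1+ q ] = refl
gap-parity -[1+ p ] (+ zero) = trans (⊖-parity 0 (suc p)) (cong (_% 2) (sym (ℕP.+-identityʳ (suc p))))
gap-parity -[1+ p ] (+ suc q) = cong (λ z → suc z % 2) (sym (ℕP.+-suc p q))
gap-parity -[1+ p ] -[1+ q ] = trans (⊖-parity (suc q) (suc p)) (cong (_% 2) (ℕP.+-comm (suc q) (suc p)))

gap-parity-cong : ∀ a b c d → ∣ a ∣ % 2 ≡ ∣ c ∣ % 2 → ∣ b ∣ % 2 ≡ ∣ d ∣ % 2 →
  ∣ a - b ∣ % 2 ≡ ∣ c - d ∣ % 2
gap-parity-cong a b c d a~c b~d = begin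
  ∣ a - b ∣ % 2                   ≡⟨ gap-parity a b ⟩
  (∣ a ∣ + ∣ b ∣) % 2             ≡⟨ %-distribˡ-+ ∣ a ∣ ∣ b ∣ 2 ⟩
  (∣ a ∣ % 2 + ∣ b ∣ % 2) % 2     ≡⟨ cong₂ (λ x y → (x + y) % 2) a~c b~d ⟩
  (∣ c ∣ % 2 + ∣ d ∣ % 2) % 2     ≡⟨ %-distribˡ-+ ∣ c ∣ ∣ d ∣ 2 ⟨
  (∣ c ∣ + ∣ d ∣) % 2             ≡⟨ gap-parity c d ⟨
  ∣ c - d ∣ % 2                   ∎

gap-parity-sym : ∀ a b → ∣ a - b ∣ % 2 ≡ ∣ b - a ∣ % 2
gap-parity-sym a b =
  trans (gap-parity a b) (trans (cong (_% 2) (ℕP.+-comm ∣ a ∣ ∣ b ∣)) (sym (gap-parity b a)))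

odd? : ℕ → Bool
odd? m = does (m % 2 ℕ.≟ 1)

odd?-cong : ∀ m n → m % 2 ≡ n % 2 → odd? m ≡ odd? n
odd?-cong m n = cong (λ r → does (r ℕ.≟ 1))

odd?-gap-sym : ∀ i j → odd? ∣ j - i ∣ ≡ odd? ∣ i - j ∣
odd?-gap-sym i j = odd?-cong ∣ j - i ∣ ∣ i - j ∣ (gap-parity-sym j i)

self-gap-even : ∀ i → odd? ∣ i - i ∣ ≡ false
self-gap-even i = cong (odd? ∘ ∣_∣) (ℤP.+-inverseʳ i)

antipodal-gap-even : ∀ i → odd? ∣ - i - i ∣ ≡ false
antipodal-gap-even i = trans (odd?-cong ∣ - i - i ∣ ∣ i - i ∣ ∣-i∣-gap) (self-gap-even i)
  where
  ∣-i∣-gap : ∣ - i - i ∣ % 2 ≡ ∣ i - i ∣ % 2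
  ∣-i∣-gap = gap-parity-cong (- i) i i i (cong (_% 2) (ℤP.∣-i∣≡∣i∣ i)) refl

oddInv : (ℤ → ℤ) → ℤ → ℤ → ℕ
oddInv F i j = 𝟙 (does (i <? j) ∧ (does (F j <? F i) ∧ odd? ∣ i - j ∣))

oddInv-≮ : ∀ F i j → ¬ i < j → oddInv F i j ≡ 0
oddInv-≮ F i j i≮j rewrite dec-false (i <? j) i≮j = refl

oddInv-even : ∀ F i j → odd? ∣ i - j ∣ ≡ false → oddInv F i j ≡ 0
oddInv-even F i j even rewrite even | ∧-zeroʳ (does (F j <? F i)) | ∧-zeroʳ (does (i <? j)) = refl

oddInv-odd< : ∀ F i j → i < j → odd? ∣ i - j ∣ ≡ true →
  oddInv F i j ≡ 𝟙 (does (F j <? F i))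
oddInv-odd< F i j i<j odd rewrite dec-true (i <? j) i<j | odd | ∧-identityʳ (does (F j <? F i)) = refl

crossing : (ℤ → ℤ) → ℤ → ℤ → ℕ
crossing F i j = oddInv F i j + oddInv F j i

crossing-sym : ∀ F i j → crossing F i j ≡ crossing F j i
crossing-sym F i j = ℕP.+-comm (oddInv F i j) (oddInv F j i)

crossing-even : ∀ F i j → odd? ∣ i - j ∣ ≡ false → crossing F i j ≡ 0
crossing-even F i j even =
  cong₂ _+_ (oddInv-even F i j even) (oddInv-even F j i (trans (odd?-gap-sym i j) even))

crossing-odd< : ∀ F i j → i < j → odd? ∣ i - j ∣ ≡ true →
  crossing F i j ≡ 𝟙 (does (F j <? F i))
crossing-odd< F i j i<j odd =
  trans (cong₂ _+_ (oddInv-odd< F i j i<j odd) (oddInv-≮ F j i (ℤP.<-asym i<j))) (ℕP.+-identityʳ _)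

module Composition (U V : ℤ → ℤ)
  (V-injective : ∀ {x y} → V x ≡ V y → x ≡ y)
  (V-parity : ∀ x → ∣ V x ∣ % 2 ≡ ∣ x ∣ % 2)
  (V-zero : V (+ 0) ≡ + 0)
  (V-pos : ∀ {x} → + 0 < x → + 0 < V x)
  (V-neg : ∀ {x} → x < + 0 → V x < + 0)
  (U-pos : ∀ {a b} → + 0 < a → a < b → U a < U b)
  (U-neg : ∀ {a b} → a < b → b < + 0 → U a < U b)
  where

  gap-parity-V : ∀ i j → ∣ V i - V j ∣ % 2 ≡ ∣ i - j ∣ % 2
  gap-parity-V i j = gap-parity-cong (V i) (V j) i j (V-parity i) (V-parity j)

  odd?-V : ∀ i j → odd? ∣ V i - V j ∣ ≡ odd? ∣ i - j ∣
  odd?-V i j = odd?-cong ∣ V i - V j ∣ ∣ i - j ∣ (gap-parity-V i j)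

  -- A pair i < j reversed by V lies on one side of 0 (V preserves signs), where
  -- U is increasing; so U keeps the reversal.
  reversal-kept : ∀ {i j} → i < j → V j < V i → U (V j) < U (V i)
  reversal-kept {i} {j} i<j Vj<Vi with ℤP.<-cmp j (+ 0)
  ... | tri< j<0 _ _ = U-neg Vj<Vi (V-neg (ℤP.<-trans i<j j<0))
  ... | tri≈ _ refl _ = ⊥-elim (ℤP.<-asym Vj<Vi (subst (V i <_) (sym V-zero) (V-neg i<j)))
  ... | tri> _ _ 0<j with ℤP.<-cmp i (+ 0)
  ...   | tri< i<0 _ _ = ⊥-elim (ℤP.<-asym Vj<Vi (ℤP.<-trans (V-neg i<0) (V-pos 0<j)))
  ...   | tri≈ _ refl _ = ⊥-elim (ℤP.<-asym Vj<Vi (subst (_< V j) (sym V-zero) (V-pos 0<j)))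
  ...   | tri> _ _ 0<i = U-pos (V-pos 0<j) Vj<Vi

  crossing-∘-< : ∀ {i j} → i < j → odd? ∣ i - j ∣ ≡ true →
    crossing (U ∘ V) i j ≡ crossing V i j + crossing U (V i) (V j)
  crossing-∘-< {i} {j} i<j odd with ℤP.<-cmp (V i) (V j)
  ... | tri< Vi<Vj _ _ = begin
    crossing (U ∘ V) i j
      ≡⟨ crossing-odd< (U ∘ V) i j i<j odd ⟩
    𝟙 (does (U (V j) <? U (V i)))
      ≡⟨ crossing-odd< U (V i) (V j) Vi<Vj (trans (odd?-V i j) odd) ⟨
    crossing U (V i) (V j)
      ≡⟨ cong (_+ crossing U (V i) (V j)) V-keeps ⟨
    crossing V i j + crossing U (V i) (V j)  ∎
    where
    V-keeps : crossing V i j ≡ 0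
    V-keeps = trans (crossing-odd< V i j i<j odd) (cong 𝟙 (dec-false (V j <? V i) (ℤP.<-asym Vi<Vj)))
  ... | tri≈ _ Vi≡Vj _ = ⊥-elim (ℤP.<⇒≢ i<j (V-injective Vi≡Vj))
  ... | tri> _ _ Vj<Vi = begin
    crossing (U ∘ V) i j
      ≡⟨ crossing-odd< (U ∘ V) i j i<j odd ⟩
    𝟙 (does (U (V j) <? U (V i)))
      ≡⟨ cong 𝟙 (dec-true (U (V j) <? U (V i)) (reversal-kept i<j Vj<Vi)) ⟩
    1
      ≡⟨ cong₂ _+_ V-reverses U-keeps ⟨
    crossing V i j + crossing U (V i) (V j)  ∎
    where
    V-reverses : crossing V i j ≡ 1
    V-reverses = trans (crossing-odd< V i j i<j odd) (cong 𝟙 (dec-true (V j <? V i) Vj<Vi))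
    U-keeps : crossing U (V i) (V j) ≡ 0
    U-keeps = begin
      crossing U (V i) (V j)
        ≡⟨ crossing-sym U (V i) (V j) ⟩
      crossing U (V j) (V i)
        ≡⟨ crossing-odd< U (V j) (V i) Vj<Vi (trans (odd?-V j i) (trans (odd?-gap-sym i j) odd)) ⟩
      𝟙 (does (U (V i) <? U (V j)))
        ≡⟨ cong 𝟙 (dec-false (U (V i) <? U (V j)) (ℤP.<-asym (reversal-kept i<j Vj<Vi))) ⟩
      0 ∎

  crossing-∘-by-parity : ∀ i j b → odd? ∣ i - j ∣ ≡ b →
    crossing (U ∘ V) i j ≡ crossing V i j + crossing U (V i) (V j)
  crossing-∘-by-parity i j false even = trans (crossing-even (U ∘ V) i j even)
    (sym (cong₂ _+_ (crossing-even V i j even) (crossing-even U (V i) (V j) (trans (odd?-V i j) even))))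
  crossing-∘-by-parity i j true odd with ℤP.<-cmp i j
  ... | tri< i<j _ _ = crossing-∘-< i<j odd
  ... | tri≈ _ refl _ = contradiction (trans (sym odd) (self-gap-even i)) λ ()
  ... | tri> _ _ j<i = begin
    crossing (U ∘ V) i j
      ≡⟨ crossing-sym (U ∘ V) i j ⟩
    crossing (U ∘ V) j i
      ≡⟨ crossing-∘-< j<i (trans (odd?-gap-sym i j) odd) ⟩
    crossing V j i + crossing U (V j) (V i)
      ≡⟨ cong₂ _+_ (crossing-sym V j i) (crossing-sym U (V j) (V i)) ⟩
    crossing V i j + crossing U (V i) (V j) ∎

  crossing-∘ : ∀ i j → crossing (U ∘ V) i j ≡ crossing V i j + crossing U (V i) (V j)
  crossing-∘ i j = crossing-∘-by-parity i j (odd? ∣ i - j ∣) refl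

inversionCount : (ℤ → ℤ) → List ℤ → ℕ
inversionCount F R = ∑∑ (oddInv F) R

inversionCount-cong : ∀ {F G} → (∀ x → F x ≡ G x) → ∀ R →
  inversionCount F R ≡ inversionCount G R
inversionCount-cong F≗G = ∑∑-cong λ i j →
  cong₂ (λ a b → 𝟙 (does (i <? j) ∧ (does (a <? b) ∧ odd? ∣ i - j ∣))) (F≗G j) (F≗G i)

∑∑-crossing : ∀ F R → ∑∑ (crossing F) R ≡ inversionCount F R + inversionCount F R
∑∑-crossing F R = trans (∑∑-+ (oddInv F) (λ i j → oddInv F j i) R)
  (cong (_+_ (inversionCount F R)) (sym (∑∑-transpose (oddInv F) R)))

inversionCount-∘ : (U V : ℤ → ℤ) (R : List ℤ) → map V R ↭ R →
  (∀ i j → crossing (U ∘ V) i j ≡ crossing V i j + crossing U (V i) (V j)) →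
  inversionCount (U ∘ V) R ≡ inversionCount U R + inversionCount V R
inversionCount-∘ U V R V-permutes crossing-splits = double-injective (begin
  cUV + cUV
    ≡⟨ ∑∑-crossing (U ∘ V) R ⟨
  ∑∑ (crossing (U ∘ V)) R
    ≡⟨ ∑∑-cong crossing-splits R ⟩
  ∑∑ (λ i j → crossing V i j + crossing U (V i) (V j)) R
    ≡⟨ ∑∑-+ (crossing V) (λ i j → crossing U (V i) (V j)) R ⟩
  ∑∑ (crossing V) R + ∑∑ (λ i j → crossing U (V i) (V j)) R
    ≡⟨ cong₂ _+_ (∑∑-crossing V R) (∑∑-reindex (crossing U) V R V-permutes) ⟩
  (cV + cV) + ∑∑ (crossing U) R
    ≡⟨ cong (_+_ (cV + cV)) (∑∑-crossing U R) ⟩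
  (cV + cV) + (cU + cU)
    ≡⟨ interchange cV cV cU cU ⟩
  (cV + cU) + (cV + cU)
    ≡⟨ cong₂ _+_ (ℕP.+-comm cV cU) (ℕP.+-comm cV cU) ⟩
  (cU + cV) + (cU + cV) ∎)
  where
  cUV cU cV : ℕ
  cUV = inversionCount (U ∘ V) R
  cU = inversionCount U R
  cV = inversionCount V R

-- For an odd function F, the involution (i , j) ↦ (- j , - i) maps odd
-- inversions to odd inversions and exchanges those with i + j < 0 and those with
-- i + j > 0; none has i + j = 0 since then the gap would be even.
module Evenness (F : ℤ → ℤ) (F-odd : ∀ x → F (- x) ≡ - F x) where

  oddInv-reflect : ∀ i j → oddInv F (- j) (- i) ≡ oddInv F i j
  oddInv-reflect i j rewrite F-odd i | F-odd j = cong₂ (λ a b → 𝟙 (a ∧ b))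
    (does-⇔ (mk⇔ ℤP.neg-cancel-< ℤP.neg-mono-<) (- j <? - i) (i <? j))
    (cong₂ _∧_ (does-⇔ (mk⇔ ℤP.neg-cancel-< ℤP.neg-mono-<) (- F i <? - F j) (F j <? F i))
               (odd?-cong ∣ - j - - i ∣ ∣ i - j ∣ gap-parity-reflect))
    where
    gap-parity-reflect : ∣ - j - - i ∣ % 2 ≡ ∣ i - j ∣ % 2
    gap-parity-reflect = trans
      (gap-parity-cong (- j) (- i) j i (cong (_% 2) (ℤP.∣-i∣≡∣i∣ j)) (cong (_% 2) (ℤP.∣-i∣≡∣i∣ i)))
      (gap-parity-sym j i)

  lower upper : ℤ → ℤ → ℕ
  lower i j = 𝟙 (does (i <? - j)) * oddInv F i j
  upper i j = 𝟙 (does (- j <? i)) * oddInv F i j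

  -- Every odd inversion is lower or upper: i = - j would make the gap even.
  oddInv-split-by-parity : ∀ i j b → odd? ∣ i - j ∣ ≡ b → oddInv F i j ≡ lower i j + upper i j
  oddInv-split-by-parity i j false even rewrite oddInv-even F i j even
    | ℕP.*-zeroʳ (𝟙 (does (i <? - j))) | ℕP.*-zeroʳ (𝟙 (does (- j <? i))) = refl
  oddInv-split-by-parity i j true odd with ℤP.<-cmp i (- j)
  ... | tri< i<-j _ _ rewrite dec-true (i <? - j) i<-j | dec-false (- j <? i) (ℤP.<-asym i<-j) =
    sym (trans (ℕP.+-identityʳ _) (ℕP.+-identityʳ _))
  ... | tri≈ _ refl _ = contradiction (trans (sym odd) (antipodal-gap-even j)) λ ()
  ... | tri> _ _ -j<i rewrite dec-false (i <? - j) (ℤP.<-asym -j<i) | dec-true (- j <? i) -j<i =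
    sym (ℕP.+-identityʳ _)

  oddInv-split : ∀ i j → oddInv F i j ≡ lower i j + upper i j
  oddInv-split i j = oddInv-split-by-parity i j (odd? ∣ i - j ∣) refl

  upper-reflect : ∀ i j → upper (- j) (- i) ≡ lower i j
  upper-reflect i j =
    cong₂ (λ a b → 𝟙 (does (a <? - j)) * b) (ℤP.neg-involutive i) (oddInv-reflect i j)

  inversionCount-even : ∀ R → map -_ R ↭ R → Even (inversionCount F R)
  inversionCount-even R R-sym = ∑∑ lower R , (begin
    inversionCount F R                   ≡⟨ ∑∑-cong oddInv-split R ⟩
    ∑∑ (λ i j → lower i j + upper i j) R  ≡⟨ ∑∑-+ lower upper R ⟩
    ∑∑ lower R + ∑∑ upper R              ≡⟨ cong (_+_ (∑∑ lower R)) upper≡lower ⟩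
    ∑∑ lower R + ∑∑ lower R              ∎)
    where
    upper≡lower : ∑∑ upper R ≡ ∑∑ lower R
    upper≡lower = begin
      ∑∑ upper R                        ≡⟨ ∑∑-reindex upper -_ R R-sym ⟨
      ∑∑ (λ i j → upper (- i) (- j)) R  ≡⟨ ∑∑-transpose (λ i j → upper (- i) (- j)) R ⟩
      ∑∑ (λ i j → upper (- j) (- i)) R  ≡⟨ ∑∑-cong upper-reflect R ⟩
      ∑∑ lower R                        ∎

ext-odd : ∀ {n} (w : Fin n → ℤ) x → ext w (- x) ≡ - ext w x
ext-odd w (+ zero) = refl
ext-odd w (+ suc k) = refl
ext-odd w -[1+ k ] = sym (ℤP.neg-involutive _)

ext-beyond : ∀ {n} (w : Fin n → ℤ) {k} → n ℕ.≤ k → ext w (+ suc k) ≡ + suc k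
ext-beyond {n} w {k} n≤k with k ℕP.<? n
... | yes k<n = contradiction n≤k (ℕP.<⇒≱ k<n)
... | no _ = refl

ext-∘ : ∀ {n} (w u v : Fin n → ℤ) → (∀ j → w j ≡ ext u (v j)) →
  ∀ x → ext w x ≡ ext u (ext v x)
ext-∘ w u v w≡uv (+ zero) = refl
ext-∘ {n} w u v w≡uv (+ suc k) with k ℕP.<? n
... | yes k<n = w≡uv (fromℕ< k<n)
... | no k≮n = sym (ext-beyond u (ℕP.≮⇒≥ k≮n))
ext-∘ w u v w≡uv -[1+ k ] =
  trans (cong -_ (ext-∘ w u v w≡uv (+ suc k))) (sym (ext-odd u (ext v (+ suc k))))

module SignedPermutation {n : ℕ} (v : Fin n → ℤ) (v∈B : IsB n v) where

  private
    v≢0 : ∀ j → v j ≢ + 0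
    v≢0 = proj₁ v∈B
    ∣v∣≤n : ∀ j → ∣ v j ∣ ℕ.≤ n
    ∣v∣≤n = proj₁ (proj₂ v∈B)
    ∣v∣-injective : ∀ i j → ∣ v i ∣ ≡ ∣ v j ∣ → i ≡ j
    ∣v∣-injective = proj₂ (proj₂ v∈B)

  ext-nonzero : ∀ k → ext v (+ suc k) ≢ + 0
  ext-nonzero k with k ℕP.<? n
  ... | yes k<n = v≢0 (fromℕ< k<n)
  ... | no _ = λ ()

  ext-bounded : ∀ x → ∣ x ∣ ℕ.≤ n → ∣ ext v x ∣ ℕ.≤ n
  ext-bounded (+ zero) _ = z≤n
  ext-bounded (+ suc k) k<n with k ℕP.<? n
  ... | yes _ = ∣v∣≤n _
  ... | no k≮n = contradiction k<n k≮n
  ext-bounded -[1+ k ] k<n =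
    subst (ℕ._≤ n) (sym (ℤP.∣-i∣≡∣i∣ (ext v (+ suc k)))) (ext-bounded (+ suc k) k<n)

  ext-∣∣-injective : ∀ k l → ∣ ext v (+ suc k) ∣ ≡ ∣ ext v (+ suc l) ∣ → k ≡ l
  ext-∣∣-injective k l eq with k ℕP.<? n | l ℕP.<? n
  ... | yes k<n | yes l<n = begin
    k                  ≡⟨ toℕ-fromℕ< k<n ⟨
    toℕ (fromℕ< k<n)   ≡⟨ cong toℕ (∣v∣-injective _ _ eq) ⟩
    toℕ (fromℕ< l<n)   ≡⟨ toℕ-fromℕ< l<n ⟩
    l                  ∎
  ... | yes _ | no l≮n = contradiction (subst (ℕ._≤ n) eq (∣v∣≤n _)) l≮n
  ... | no k≮n | yes _ = contradiction (subst (ℕ._≤ n) (sym eq) (∣v∣≤n _)) k≮n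
  ... | no _ | no _ = ℕP.suc-injective eq

  ext-not-antipodal : ∀ k l → ext v (+ suc k) ≢ - ext v (+ suc l)
  ext-not-antipodal k l eq
    with ext-∣∣-injective k l (trans (cong ∣_∣ eq) (ℤP.∣-i∣≡∣i∣ (ext v (+ suc l))))
  ... | refl = ext-nonzero k (self-antipodal eq)
    where
    self-antipodal : ∀ {a} → a ≡ - a → a ≡ + 0
    self-antipodal {+ zero} _ = refl
    self-antipodal {+ suc _} ()
    self-antipodal { -[1+ _ ]} ()

  ext-injective : ∀ {x y} → ext v x ≡ ext v y → x ≡ y
  ext-injective {+ zero} {+ zero} _ = refl
  ext-injective {+ zero} {+ suc l} eq = ⊥-elim (ext-nonzero l (sym eq))
  ext-injective {+ zero} { -[1+ l ]} eq = ⊥-elim (ext-nonzero l (ℤP.neg-injective (sym eq)))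
  ext-injective {+ suc k} {+ zero} eq = ⊥-elim (ext-nonzero k eq)
  ext-injective { -[1+ k ]} {+ zero} eq = ⊥-elim (ext-nonzero k (ℤP.neg-injective eq))
  ext-injective {+ suc k} {+ suc l} eq = cong (λ m → + suc m) (ext-∣∣-injective k l (cong ∣_∣ eq))
  ext-injective { -[1+ k ]} { -[1+ l ]} eq =
    cong -[1+_] (ext-∣∣-injective k l (cong ∣_∣ (ℤP.neg-injective eq)))
  ext-injective {+ suc k} { -[1+ l ]} eq = ⊥-elim (ext-not-antipodal k l eq)
  ext-injective { -[1+ k ]} {+ suc l} eq = ⊥-elim (ext-not-antipodal l k (sym eq))

  ext-parity : IsC0 n v → ∀ x → ∣ ext v x ∣ % 2 ≡ ∣ x ∣ % 2
  ext-parity _ (+ zero) = refl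
  ext-parity v∈C (+ suc k) with k ℕP.<? n
  ... | yes k<n = trans (proj₂ v∈C (fromℕ< k<n)) (cong (λ m → suc m % 2) (toℕ-fromℕ< k<n))
  ... | no _ = refl
  ext-parity v∈C -[1+ k ] =
    trans (cong (_% 2) (ℤP.∣-i∣≡∣i∣ (ext v (+ suc k)))) (ext-parity v∈C (+ suc k))

ext-positive : ∀ {n} (v : Fin n → ℤ) → IsS n v → ∀ {x} → + 0 < x → + 0 < ext v x
ext-positive {n} v v∈S {+ suc k} _ with k ℕP.<? n
... | yes k<n = proj₂ v∈S (fromℕ< k<n)
... | no _ = +<+ (s≤s z≤n)
ext-positive v v∈S {+ zero} (+<+ ())

ext-negative : ∀ {n} (v : Fin n → ℤ) → IsS n v → ∀ {x} → x < + 0 → ext v x < + 0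
ext-negative v v∈S { -[1+ k ]} _ = ℤP.neg-mono-< (ext-positive v v∈S {+ suc k} (+<+ (s≤s z≤n)))
ext-negative v v∈S {+ _} (+<+ ())

module AscendingPermutation {n : ℕ} (u : Fin n → ℤ) (u∈B : IsB n u) (u↑ : Ascending n u) where

  private
    i≤+∣i∣ : ∀ i → i ≤ + ∣ i ∣
    i≤+∣i∣ (+ _) = ℤP.≤-refl
    i≤+∣i∣ -[1+ _ ] = -≤+

  ext-increasing-suc : ∀ {k l} → k ℕ.< l → ext u (+ suc k) < ext u (+ suc l)
  ext-increasing-suc {k} {l} k<l with k ℕP.<? n | l ℕP.<? n
  ... | yes k<n | yes l<n =
    u↑ _ _ (subst₂ ℕ._<_ (sym (toℕ-fromℕ< k<n)) (sym (toℕ-fromℕ< l<n)) k<l)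
  ... | yes k<n | no l≮n = ℤP.≤-<-trans (ℤP.≤-trans (i≤+∣i∣ _) (+≤+ (proj₁ (proj₂ u∈B) _)))
                                         (+<+ (s≤s (ℕP.≮⇒≥ l≮n)))
  ... | no k≮n | yes l<n = contradiction (ℕP.<-trans k<l l<n) k≮n
  ... | no _ | no _ = +<+ (s≤s k<l)

  ext-increasing-pos : ∀ {a b} → + 0 < a → a < b → ext u a < ext u b
  ext-increasing-pos {+ suc k} {+ suc l} _ (+<+ k<l) = ext-increasing-suc (ℕ.s<s⁻¹ k<l)
  ext-increasing-pos {+ zero} (+<+ ()) _

  ext-increasing-neg : ∀ {a b} → a < b → b < + 0 → ext u a < ext u b
  ext-increasing-neg { -[1+ k ]} { -[1+ l ]} (ℤ.-<- l<k) _ = ℤP.neg-mono-< (ext-increasing-suc l<k)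
  ext-increasing-neg { -[1+ _ ]} {+ _} _ (+<+ ())

module Range (n : ℕ) where

  shift : ℕ → ℤ
  shift k = + k - + n

  shift-injective : ∀ {k l} → shift k ≡ shift l → k ≡ l
  shift-injective {k} {l} eq = ℤP.+-injective (∙-cancelʳ (- + n) (+ k) (+ l) eq)

  pmRange-unique : Unique (pmRange n)
  pmRange-unique = Unique.map⁺ shift-injective (Unique.upTo⁺ _)

  shift-bounded : ∀ {k} → k ℕ.< suc (2 * n) → ∣ shift k ∣ ℕ.≤ n
  shift-bounded {k} k<2n+1 rewrite ℤP.m-n≡m⊖n k n with ℕP.≤-total k n
  ... | inj₁ k≤n rewrite ℤP.∣⊖∣-≤ k≤n = ℕP.m∸n≤m n k
  ... | inj₂ n≤k rewrite ℤP.∣m⊖n∣≡∣n⊖m∣ k n | ℤP.∣⊖∣-≤ n≤k =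
    ℕP.m≤n+o⇒m∸n≤o k n
      (subst (k ℕ.≤_) (cong (_+_ n) (ℕP.+-identityʳ n)) (ℕ.s≤s⁻¹ k<2n+1))

  ∈-pmRange⁻ : ∀ {x} → x ∈ pmRange n → ∣ x ∣ ℕ.≤ n
  ∈-pmRange⁻ x∈ with ∈-map⁻ shift x∈
  ... | k , k∈ , refl = shift-bounded (∈-upTo⁻ k∈)

  ∈-pmRange⁺ : ∀ {x} → ∣ x ∣ ℕ.≤ n → x ∈ pmRange n
  ∈-pmRange⁺ {+ m} m≤n =
    subst (_∈ pmRange n) shift-n+m (∈-map⁺ shift (∈-upTo⁺ (s≤s n+m≤2n)))
    where
    n+m≤2n : n + m ℕ.≤ 2 * n
    n+m≤2n = subst (n + m ℕ.≤_) (cong (_+_ n) (sym (ℕP.+-identityʳ n))) (ℕP.+-monoʳ-≤ n m≤n)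
    shift-n+m : shift (n + m) ≡ + m
    shift-n+m = begin
      shift (n + m)         ≡⟨ ℤP.m-n≡m⊖n (n + m) n ⟩
      (n + m) ⊖ n           ≡⟨ cong ((n + m) ⊖_) (sym (ℕP.+-identityʳ n)) ⟩
      (n + m) ⊖ (n + 0)     ≡⟨ ℤP.+-cancelˡ-⊖ n m 0 ⟩
      m ⊖ 0                 ≡⟨ ℤP.⊖-≥ z≤n ⟩
      + m                   ∎
  ∈-pmRange⁺ { -[1+ m ]} m<n =
    subst (_∈ pmRange n) shift-n-m (∈-map⁺ shift (∈-upTo⁺ (s≤s n-m≤2n)))
    where
    n-m≤2n : n ℕ.∸ suc m ℕ.≤ 2 * n
    n-m≤2n = ℕP.≤-trans (ℕP.m∸n≤m n (suc m)) (ℕP.m≤m+n n _)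
    shift-n-m : shift (n ℕ.∸ suc m) ≡ -[1+ m ]
    shift-n-m = begin
      shift (n ℕ.∸ suc m)             ≡⟨ ℤP.m-n≡m⊖n (n ℕ.∸ suc m) n ⟩
      (n ℕ.∸ suc m) ⊖ n               ≡⟨ ℤP.⊖-≤ (ℕP.m∸n≤m n (suc m)) ⟩
      - + (n ℕ.∸ (n ℕ.∸ suc m))       ≡⟨ cong (λ k → - + k) (ℕP.m∸[m∸n]≡n m<n) ⟩
      -[1+ m ]                        ∎

  pmRange-↭ : (g : ℤ → ℤ) → (∀ {x y} → g x ≡ g y → x ≡ y) →
    (∀ x → ∣ x ∣ ℕ.≤ n → ∣ g x ∣ ℕ.≤ n) →
    map g (pmRange n) ↭ pmRange n
  pmRange-↭ g g-injective g-bounded = injective-map-↭ ℤP._≟_ g pmRange-unique g-injective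
    (λ x∈ → ∈-pmRange⁺ (g-bounded _ (∈-pmRange⁻ x∈)))

  pmRange-neg : map -_ (pmRange n) ↭ pmRange n
  pmRange-neg = pmRange-↭ -_ ℤP.neg-injective λ x → subst (ℕ._≤ n) (sym (ℤP.∣-i∣≡∣i∣ x))

L≡half-count : ∀ {n} (w : Fin n → ℤ) → L w ≡ ⌊ inversionCount (ext w) (pmRange n) /2⌋
L≡half-count {n} w = cong ⌊_/2⌋
  (trans (length-filter _ (cartesianProduct (pmRange n) (pmRange n)))
         (∑-cartesianProduct _ (pmRange n) (pmRange n)))

proposition5p10 : (n : ℕ) (w u v : Fin n → ℤ) →
    IsC0 n w → Ascending n u → IsB n u → IsS n v →
    (∀ j → w j ≡ ext u (v j)) →
    IsC0 n u → IsC0 n v →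
    L w ≡ L u + L v
proposition5p10 n w u v _ u↑ u∈B v∈S w≡uv _ v∈C = begin
  L w                              ≡⟨ L≡half-count w ⟩
  ⌊ count (ext w) /2⌋              ≡⟨ cong ⌊_/2⌋ count-w ⟩
  ⌊ count U + count V /2⌋          ≡⟨ half-+-even (count-even U (ext-odd u)) (count-even V (ext-odd v)) ⟩
  ⌊ count U /2⌋ + ⌊ count V /2⌋    ≡⟨ cong₂ _+_ (L≡half-count u) (L≡half-count v) ⟨
  L u + L v                        ∎
  where
  U V : ℤ → ℤ
  U = ext u
  V = ext v
  count : (ℤ → ℤ) → ℕ
  count F = inversionCount F (pmRange n)
  count-even : ∀ F → (∀ x → F (- x) ≡ - F x) → Even (count F)
  count-even F F-odd = Evenness.inversionCount-even F F-odd (pmRange n) (Range.pmRange-neg n)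
  open SignedPermutation v (proj₁ v∈S)
  open AscendingPermutation u u∈B u↑
  open Composition U V ext-injective (ext-parity v∈C) refl (ext-positive v v∈S) (ext-negative v v∈S)
                   ext-increasing-pos ext-increasing-neg
  count-w : count (ext w) ≡ count U + count V
  count-w = trans (inversionCount-cong (ext-∘ w u v w≡uv) (pmRange n))
                  (inversionCount-∘ U V (pmRange n) V-permutes crossing-∘)
    where
    V-permutes : map V (pmRange n) ↭ pmRange n
    V-permutes = Range.pmRange-↭ n V ext-injective ext-bounded
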